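{- For every state $p$ of an LTS with inputs and outputs and every formula $\phi\in\mathcal L_{\mathsf{iocos}}$: (i) if $p\models\phi$ then $p\not\models\mathcal T(\phi)$; and (ii) if $p\not\models\phi$ then $p\models\mathcal T(\phi)$.
   Context: Actions: disjoint finite sets $I$ (inputs $a?$) and $O$ (outputs $a!$, including quiescence $\delta!$). An LTS with inputs and outputs is $(S,I,O,\to)$ with $\to\subseteq S\times(I\cup O)\times S$ such that $p\xrightarrow{\delta!}p'$ iff $p=p'$ and $p$ has no $a!$-transition for $a!\in O\setminus\{\delta!\}$; LTSs are image-finite. The logic $\mathcal L_{\mathsf{iocos}}$: $\phi::=\mathrm{tt}\mid\mathrm{ff}\mid\phi\wedge\phi\mid\phi\vee\phi\mid\langle\!\langle a?\rangle\!\rangle\phi\mid\langle a!\rangle\phi$, where $p\models\langle a!\rangle\phi$ iff some $p\xrightarrow{a!}p'$ has $p'\models\phi$, and $p\models\langle\!\langle a?\rangle\!\rangle\phi$ iff $p$ has no $a?$-transition or some $p\xrightarrow{a?}p'$ has $p'\models\phi$. The logic $\widetilde{\mathcal L}_{\mathsf{iocos}}$: $\phi::=\mathrm{tt}\mid\mathrm{ff}\mid\phi\wedge\phi\mid\phi\vee\phi\mid[\![a?]\!]\phi\mid[a!]\phi$, where $p\models[a!]\phi$ iff all $a!$-successors of $p$ satisfy $\phi$, and $p\models[\![a?]\!]\phi$ iff $p$ has at least one $a?$-transition and all $a?$-successors satisfy $\phi$. The map $\mathcal T:\mathcal L_{\mathsf{iocos}}\to\widetilde{\mathcal L}_{\mathsf{iocos}}$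 is defined by $\mathcal T(\mathrm{tt})=\mathrm{ff}$, $\mathcal T(\mathrm{ff})=\mathrm{tt}$, $\mathcal T(\phi_1\wedge\phi_2)=\mathcal T(\phi_1)\vee\mathcal T(\phi_2)$, $\mathcal T(\phi_1\vee\phi_2)=\mathcal T(\phi_1)\wedge\mathcal T(\phi_2)$, $\mathcal T(\langle\!\langle a?\rangle\!\rangle\phi)=[\![a?]\!]\mathcal T(\phi)$, $\mathcal T(\langle a!\rangle\phi)=[a!]\mathcal T(\phi)$. -}

module Defs where

open import Data.Nat using (ℕ)
open import Data.Fin using (Fin)
open import Data.List using (List; [])
open import Data.List.Membership.Propositional using (_∈_)
open import Data.List.Relation.Unary.Any using (Any)
open import Data.List.Relation.Unary.All using (All)
open import Data.Product using (_×_; ∃)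
open import Data.Sum using (_⊎_)
open import Data.Empty using (⊥)
open import Data.Unit using (⊤)
open import Relation.Nullary using (¬_)
open import Relation.Binary.PropositionalEquality using (_≡_; _≢_)
open import Function.Bundles using (_⇔_)

data Act (ni no : ℕ) : Set where
  inp : Fin ni → Act ni no
  out : Fin no → Act ni no

-- An image-finite LTS with inputs and outputs: for each state and action,
-- the finite list of successor states. `δ` is the quiescence output δ!.
record IOLTS (ni no : ℕ) (δ : Fin no) : Set₁ where
  field
    State : Set
    succ  : State → Act ni no → List State
    quiescence : ∀ p p' →
      (p' ∈ succ p (out δ)) ⇔ (p' ≡ p × (∀ o → o ≢ δ → succ p (out o) ≡ []))

data Formula (ni no : ℕ) : Set where
  tt ff : Formula ni no
  _∧_ _∨_ : Formula ni no → Formula ni no → Formula ni no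
  ⟪_⟫_ : Fin ni → Formula ni no → Formula ni no
  ⟨_⟩_ : Fin no → Formula ni no → Formula ni no

data DFormula (ni no : ℕ) : Set where
  tt ff : DFormula ni no
  _∧_ _∨_ : DFormula ni no → DFormula ni no → DFormula ni no
  ⟦_⟧_ : Fin ni → DFormula ni no → DFormula ni no
  [_]_ : Fin no → DFormula ni no → DFormula ni no

module _ {ni no : ℕ} {δ : Fin no} (L : IOLTS ni no δ) where
  open IOLTS L

  _⊨_ : State → Formula ni no → Set
  p ⊨ tt = ⊤
  p ⊨ ff = ⊥
  p ⊨ (φ ∧ ψ) = (p ⊨ φ) × (p ⊨ ψ)
  p ⊨ (φ ∨ ψ) = (p ⊨ φ) ⊎ (p ⊨ ψ)
  p ⊨ (⟪ a ⟫ φ) = (succ p (inp a) ≡ []) ⊎ Any (λ p' → p' ⊨ φ) (succ p (inp a))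
  p ⊨ (⟨ a ⟩ φ) = Any (λ p' → p' ⊨ φ) (succ p (out a))

  _⊨~_ : State → DFormula ni no → Set
  p ⊨~ tt = ⊤
  p ⊨~ ff = ⊥
  p ⊨~ (φ ∧ ψ) = (p ⊨~ φ) × (p ⊨~ ψ)
  p ⊨~ (φ ∨ ψ) = (p ⊨~ φ) ⊎ (p ⊨~ ψ)
  p ⊨~ (⟦ a ⟧ φ) = (succ p (inp a) ≢ []) × All (λ p' → p' ⊨~ φ) (succ p (inp a))
  p ⊨~ ([ a ] φ) = All (λ p' → p' ⊨~ φ) (succ p (out a))

T : {ni no : ℕ} → Formula ni no → DFormula ni no
T tt = ff
T ff = tt
T (φ ∧ ψ) = T φ ∨ T ψ
T (φ ∨ ψ) = T φ ∧ T ψ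
T (⟪ a ⟫ φ) = ⟦ a ⟧ T φ
T (⟨ a ⟩ φ) = [ a ] T φ

-- Both parts go by induction on φ, T swapping each connective and modality
-- with its De Morgan dual.  Part (ii) at a conjunction must decide which
-- conjunct fails; this is constructive because satisfaction of L_iocos is
-- decidable on an image-finite LTS.
module Submission where

open import Defs
open import Data.Nat using (ℕ)
open import Data.Fin using (Fin)
open import Data.Product using (_×_; _,_)
open import Data.Sum using (inj₁; inj₂)
open import Data.Unit using (tt)
open import Data.List using (List; []; _∷_)
open import Data.List.Relation.Unary.Any using (any?)
import Data.List.Relation.Unary.All as All
open import Data.List.Relation.Unary.All.Properties using (All¬⇒¬Any; ¬Any⇒All¬)
open import Function using (_∘_; id)
open import Relation.Nullary using (¬_; Dec; yes; no; _×-dec_; _⊎-dec_)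
open import Relation.Binary.PropositionalEquality using (_≡_; refl)

≡[]? : {A : Set} (xs : List A) → Dec (xs ≡ [])
≡[]? []      = yes refl
≡[]? (_ ∷ _) = no λ ()

module _ {nᵢ nₒ : ℕ} {δ : Fin nₒ} (L : IOLTS nᵢ nₒ δ) where
  ⊨? : ∀ p φ → Dec (_⊨_ L p φ)
  ⊨? p tt        = yes tt
  ⊨? p ff        = no id
  ⊨? p (φ ∧ ψ)   = ⊨? p φ ×-dec ⊨? p ψ
  ⊨? p (φ ∨ ψ)   = ⊨? p φ ⊎-dec ⊨? p ψ
  ⊨? p (⟪ a ⟫ φ) = ≡[]? _ ⊎-dec any? (λ q → ⊨? q φ) _
  ⊨? p (⟨ a ⟩ φ) = any? (λ q → ⊨? q φ) _

  ⊨⇒¬⊨T : ∀ p φ → _⊨_ L p φ → ¬ _⊨~_ L p (T φ)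
  ⊨⇒¬⊨T p ff        ()
  ⊨⇒¬⊨T p (φ ∧ ψ)   (sφ , _)  (inj₁ tφ) = ⊨⇒¬⊨T p φ sφ tφ
  ⊨⇒¬⊨T p (φ ∧ ψ)   (_ , sψ)  (inj₂ tψ) = ⊨⇒¬⊨T p ψ sψ tψ
  ⊨⇒¬⊨T p (φ ∨ ψ)   (inj₁ sφ) (tφ , _)  = ⊨⇒¬⊨T p φ sφ tφ
  ⊨⇒¬⊨T p (φ ∨ ψ)   (inj₂ sψ) (_ , tψ)  = ⊨⇒¬⊨T p ψ sψ tψ
  ⊨⇒¬⊨T p (⟪ a ⟫ φ) (inj₁ none) (some , _) = some none
  ⊨⇒¬⊨T p (⟪ a ⟫ φ) (inj₂ s) (_ , t) =
    All¬⇒¬Any (All.map (λ {q} tq sq → ⊨⇒¬⊨T q φ sq tq) t) s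
  ⊨⇒¬⊨T p (⟨ a ⟩ φ) s t =
    All¬⇒¬Any (All.map (λ {q} tq sq → ⊨⇒¬⊨T q φ sq tq) t) s

  ¬⊨⇒⊨T : ∀ p φ → ¬ _⊨_ L p φ → _⊨~_ L p (T φ)
  ¬⊨⇒⊨T p tt ¬s = ¬s tt
  ¬⊨⇒⊨T p ff _  = tt
  ¬⊨⇒⊨T p (φ ∧ ψ) ¬s with ⊨? p φ
  ... | yes sφ = inj₂ (¬⊨⇒⊨T p ψ (¬s ∘ (sφ ,_)))
  ... | no ¬sφ = inj₁ (¬⊨⇒⊨T p φ ¬sφ)
  ¬⊨⇒⊨T p (φ ∨ ψ) ¬s = ¬⊨⇒⊨T p φ (¬s ∘ inj₁) , ¬⊨⇒⊨T p ψ (¬s ∘ inj₂)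
  ¬⊨⇒⊨T p (⟪ a ⟫ φ) ¬s =
    ¬s ∘ inj₁ , All.map (¬⊨⇒⊨T _ φ) (¬Any⇒All¬ _ (¬s ∘ inj₂))
  ¬⊨⇒⊨T p (⟨ a ⟩ φ) ¬s = All.map (¬⊨⇒⊨T _ φ) (¬Any⇒All¬ _ ¬s)

lemma1 : {ni no : ℕ} {δ : Fin no} (L : IOLTS ni no δ) (p : IOLTS.State L) (φ : Formula ni no) →
    (_⊨_ L p φ → ¬ _⊨~_ L p (T φ)) × (¬ _⊨_ L p φ → _⊨~_ L p (T φ))
lemma1 L p φ = ⊨⇒¬⊨T L p φ , ¬⊨⇒⊨T L p φ
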